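{- Let $k,x,a,b$ be positive integers such that $k=a+b$, and assume $1\le k\le 10$. Then \[\binom{2k}{k}=\binom{2a}{a}\binom{x+2b}{b}\] if and only if $x=a=1$. -}

module Defs where

-- Pascal's rule and symmetry give C(2n+2, n+1) = 2 C(2n+1, n), which is the
-- "if" direction for every b.  Conversely, x ↦ C(x+2b, b) is monotone, so a
-- solution with x ≥ 2 would need C(2k, k) ≥ C(2a, a) C(2b+2, b).  For the 45
-- pairs of positive a, b with a + b ≤ 10 a direct computation shows that this
-- fails, and that at x = 1 the equation holds only for a = 1.
{-# OPTIONS --safe #-}
module Submission where

open import Defs
open import Data.Nat using (ℕ; _+_; _*_; _≤_)
open import Data.Nat.Combinatorics using (_C_)
open import Data.Product using (_×_)
open import Relation.Binary.PropositionalEquality using (_≡_)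
open import Function.Bundles using (_⇔_)

open import Data.Nat using (zero; suc; _∸_; _<_; _≤′_; ≤′-refl; ≤′-step; s≤s)
open import Data.Nat.Properties
open import Data.Nat.Combinatorics using (nCk≡nC[n∸k]; nCk+nC[k+1]≡[n+1]C[k+1])
open import Data.Product using (_,_; proj₁; proj₂)
open import Function.Bundles using (mk⇔)
open import Relation.Binary.Core using (_Preserves_⟶_)
open import Relation.Binary.PropositionalEquality using (refl; trans; cong; subst; module ≡-Reasoning)
open import Relation.Nullary.Decidable using (Dec; from-yes; _×-dec_; _→-dec_)
open import Function.Base using (_∘_)

centralBinomial : ℕ → ℕ
centralBinomial n = (2 * n) C n

nCk≤[1+n]Ck : ∀ n k → n C k ≤ suc n C k
nCk≤[1+n]Ck n zero    = ≤-refl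
nCk≤[1+n]Ck n (suc k) =
  ≤-trans (m≤n+m (n C suc k) (n C k)) (≤-reflexive (nCk+nC[k+1]≡[n+1]C[k+1] n k))

C-monoˡ-≤ : ∀ k → (_C k) Preserves _≤_ ⟶ _≤_
C-monoˡ-≤ k m≤n = mono (≤⇒≤′ m≤n)
  where
  mono : ∀ {m n} → m ≤′ n → m C k ≤ n C k
  mono ≤′-refl        = ≤-refl
  mono (≤′-step m≤′n) = ≤-trans (mono m≤′n) (nCk≤[1+n]Ck _ k)

centralBinomial-suc : ∀ n → centralBinomial (suc n) ≡ 2 * ((1 + 2 * n) C n)
centralBinomial-suc n = begin
  (2 * suc n) C suc n     ≡⟨ cong (_C suc n) (*-suc 2 n) ⟩
  suc m C suc n           ≡⟨ nCk+nC[k+1]≡[n+1]C[k+1] m n ⟨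
  m C n + m C suc n       ≡⟨ cong (m C n +_) (nCk≡nC[n∸k] (s≤s (m≤m+n n (n + 0)))) ⟩
  m C n + m C (m ∸ suc n) ≡⟨ cong (λ i → m C n + m C i) m∸[1+n]≡n ⟩
  m C n + m C n           ≡⟨ cong (m C n +_) (+-identityʳ (m C n)) ⟨
  2 * (m C n)             ∎
  where
  open ≡-Reasoning
  m : ℕ
  m = 1 + 2 * n
  m∸[1+n]≡n : m ∸ suc n ≡ n
  m∸[1+n]≡n = trans (m+n∸m≡n n (n + 0)) (+-identityʳ n)

monotone-reflects-< : ∀ {f : ℕ → ℕ} → f Preserves _≤_ ⟶ _≤_ → ∀ {m n} → f m < f n → m < n
monotone-reflects-< f-mono fm<fn = ≰⇒> (λ n≤m → <⇒≱ fm<fn (f-mono n≤m))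

SmallCase : ℕ → ℕ → Set
SmallCase a b =
  centralBinomial (a + b) < centralBinomial a * ((2 + 2 * b) C b) ×
  (centralBinomial (a + b) ≡ centralBinomial a * ((1 + 2 * b) C b) → a ≡ 1)

smallCase? : ∀ a b → Dec (SmallCase a b)
smallCase? a b = (_ <? _) ×-dec ((_ ≟ _) →-dec (a ≟ 1))

smallCase : ∀ {a b} → 1 ≤ b → a + b ≤ 10 → SmallCase a b
smallCase {a} {b} 1≤b a+b≤10 = from-yes allSmallCases? a<11 b<11 1≤b a+b≤10
  where
  a<11 : a < 11
  a<11 = s≤s (≤-trans (m≤m+n a b) a+b≤10)
  b<11 : b < 11
  b<11 = s≤s (≤-trans (m≤n+m b a) a+b≤10)
  allSmallCases? : Dec (∀ {a} → a < 11 → ∀ {b} → b < 11 → 1 ≤ b → a + b ≤ 10 → SmallCase a b)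
  allSmallCases? =
    allUpTo? (λ a → allUpTo? (λ b → (1 ≤? b) →-dec (a + b ≤? 10) →-dec smallCase? a b) 11) 11

lemma2p2 : (k x a b : ℕ) → 1 ≤ x → 1 ≤ a → 1 ≤ b → k ≡ a + b → 1 ≤ k → k ≤ 10 →
    (((2 * k) C k ≡ ((2 * a) C a) * ((x + 2 * b) C b)) ⇔ ((x ≡ 1) × (a ≡ 1)))
lemma2p2 k x a b 1≤x _ 1≤b refl _ k≤10 = mk⇔ onlyIf if
  where
  f : ℕ → ℕ
  f y = centralBinomial a * ((y + 2 * b) C b)

  f-mono : f Preserves _≤_ ⟶ _≤_
  f-mono = *-monoʳ-≤ (centralBinomial a) ∘ C-monoˡ-≤ b ∘ +-monoˡ-≤ (2 * b)

  x≡1 : centralBinomial (a + b) ≡ f x → x ≡ 1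
  x≡1 eq = ≤-antisym (≤-pred x<2) 1≤x
    where
    x<2 : x < 2
    x<2 = monotone-reflects-< {f} f-mono (subst (_< f 2) eq (proj₁ (smallCase 1≤b k≤10)))

  onlyIf : centralBinomial (a + b) ≡ f x → (x ≡ 1) × (a ≡ 1)
  onlyIf eq = x≡1 eq , proj₂ (smallCase 1≤b k≤10) (subst ((centralBinomial (a + b) ≡_) ∘ f) (x≡1 eq) eq)

  if : (x ≡ 1) × (a ≡ 1) → centralBinomial (a + b) ≡ f x
  if (refl , refl) = centralBinomial-suc b
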